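{- Let $S\subseteq\mathcal{P}[n]$ and $i,j\in[n]$. If $S$ is $j$-down, then both $D_i(S)$ and $C_i(S)$ are $j$-down.
   Context: For $S\subseteq\mathcal{P}[n]$ and $i\in[n]$, define $C_i(S)=\{x\in S: x\setminus\{i\}\in S\}$ and $D_i(S)=S\cup\{x: x\cup\{i\}\in S\}$. A set $S$ is called $i$-down if $x\in S$ implies $x\setminus\{i\}\in S$. -}

module Defs where

open import Level using (Level; suc)
open import Data.Nat using (ℕ)
open import Data.Fin using (Fin)
open import Data.Fin.Subset using (Subset; inside; outside)
open import Data.Vec using (_[_]≔_)
open import Data.Product using (_×_)
open import Data.Sum using (_⊎_)

-- A family S ⊆ 𝒫[n] of subsets of [n] = Fin n, given as a predicate on Subset n.
Family : ℕ → Set₁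
Family n = Subset n → Set

_－_ : ∀ {n} → Subset n → Fin n → Subset n
x － i = x [ i ]≔ outside

_＋_ : ∀ {n} → Subset n → Fin n → Subset n
x ＋ i = x [ i ]≔ inside

C : ∀ {n} → Fin n → Family n → Family n
C i S x = S x × S (x － i)

D : ∀ {n} → Fin n → Family n → Family n
D i S x = S x ⊎ S (x ＋ i)

IsDown : ∀ {n} → Fin n → Family n → Set
IsDown i S = ∀ x → S x → S (x － i)

-- The whole argument rests on one fact about a j-down family S: if S
-- contains x with coordinate i set to some value b, and i ≠ j, then it also
-- contains (x ∖ {j}) with coordinate i set to b.  This is because updates at
-- distinct coordinates commute, so removing j from x[i]≔b is the same as
-- setting coordinate i of x ∖ {j} to b (lemma down-under-update).
--
-- For D_i(S) = S ∪ {x : x ∪ {i} ∈ S} the first part is immediate from S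
-- being j-down; for the second part, i ≠ j is the lemma with b = inside,
-- and i = j holds because (x ∖ {i}) ∪ {i} = x ∪ {i}.
-- For C_i(S) = {x ∈ S : x ∖ {i} ∈ S}, the case i ≠ j is the lemma with
-- b = outside, and i = j is just S being i-down applied twice.
module Submission where

open import Defs
open import Data.Nat using (ℕ)
open import Data.Fin using (Fin; _≟_)
open import Data.Fin.Subset using (Subset; Side)
open import Data.Vec using (_[_]≔_)
open import Data.Product using (_×_; _,_)
open import Data.Sum using (inj₁; inj₂)
open import Data.Vec.Properties using ([]≔-idempotent; []≔-commutes)
open import Relation.Binary.PropositionalEquality using (_≡_; _≢_; refl; sym; subst)
open import Relation.Nullary using (yes; no)

down-under-update : ∀ {n} {S : Family n} {i j : Fin n} → IsDown j S → i ≢ j →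
  ∀ (x : Subset n) (b : Side) → S (x [ i ]≔ b) → S ((x － j) [ i ]≔ b)
down-under-update {S = S} {i} {j} down i≢j x b s =
  subst S ([]≔-commutes x i j i≢j) (down (x [ i ]≔ b) s)

＋-after-－ : ∀ {n} (x : Subset n) (i : Fin n) → (x － i) ＋ i ≡ x ＋ i
＋-after-－ x i = []≔-idempotent x i

D-down : ∀ {n} (S : Family n) (i j : Fin n) → IsDown j S → IsDown j (D i S)
D-down S i j down x (inj₁ x∈S) = inj₁ (down x x∈S)
D-down S i j down x (inj₂ x+i∈S) with i ≟ j
... | yes refl = inj₂ (subst S (sym (＋-after-－ x i)) x+i∈S)
... | no i≢j   = inj₂ (down-under-update down i≢j x _ x+i∈S)

C-down : ∀ {n} (S : Family n) (i j : Fin n) → IsDown j S → IsDown j (C i S)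
C-down S i j down x (x∈S , x-i∈S) with i ≟ j
... | yes refl = down x x∈S , down (x － i) x-i∈S
... | no i≢j   = down x x∈S , down-under-update down i≢j x _ x-i∈S

mainTheorem5 : (n : ℕ) (S : Family n) (i j : Fin n) →
    IsDown j S → IsDown j (D i S) × IsDown j (C i S)
mainTheorem5 n S i j down = D-down S i j down , C-down S i j down
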